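{- Consider the system $p_1(S,m,x,y)=p_2(S,m,x,y)=p_3(S,m,x,y)=0$. Every integral solution $(S_0,m_0,x_0,y_0)$ with $S_0\neq0$, $m_0\neq 0$, $x_0\geq 1$ for which the quantities $\Lambda,T,n,k,r,s,\lambda,N,P$ defined below are all integers at $(S_0,m_0,x_0,y_0)$ lies on one of the following parametrized curves (parameter $z$): (i) $S=\tfrac12 z(3z+1)$, $m=\tfrac92 z(z+1)$, $x=\tfrac12 z(z+1)$, $y=\tfrac12 z(z-1)$; (ii) $S=m=x=y=z$; (iii) $S=z+1$, $m=z$, $x=z$, $y=z+1$.
   Context: $p_1= S^4 - 2S^2xm + x^2m^2 - 2S^3 + 2S^2x - 2Sxm + 2x^2m + S^2 - 2Sx + x^2$; $p_2= S^4 + 2S^2xm - 4S^2ym + x^2m^2 - 4xym^2 + 4y^2m^2 - 2S^3 + 2S^2x + 8S^2m - 6Sxm - 2x^2m- 4Sym + 4xym - 4Sm^2 + 4xm^2 + S^2 - 2Sx + x^2$; $p_3=S^2x^2 - Smx^2 - 2S^2xy + 2Smxy + S^2y^2 - Smy^2 + S^2m + 2S^2x - 2Smx - 2Sx^2 + mx^2 - 2S^2y + 2Sxy + S^2 - 2Sx + x^2$. $\Lambda=\frac{S(S-1)(S-x)(S-y)}{S^4-2S^3-((x+y-1)(m-1)-1)S^2+xym(m-1)}$, $T=\frac{(m-1)\Lambda}{S-1}$, $N=\frac{x(m-S)(S(S-1)-y(m-1))\Lambda}{S(x-y)(S-x)(S-1)}$, $P=\frac{(S(S-1)-y(m-1))\Lambda}{(x-y)(S-1)}$,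 $r=\frac{1}{x-y}\left(\frac{(m-S)\Lambda}{S-1}-(S-y)\right)$, $k=\frac{(m-S)(S(S-1)-y(m-1))\Lambda}{(x-y)(S-x)(S-1)}$, $n=\frac{mT}{S}$, $s=\frac{y-S}{x-y}$, $\lambda=k+r+s+rs$ (parameters of a quasi-symmetric design with intersection numbers $x,y$ and of its block graph). -}

module Defs where

open import Data.Integer as Int using (ℤ; +_)
open import Data.Rational as Q using (ℚ; 0ℚ; _÷_; ≢-nonZero)
open import Data.Rational.Properties using (_≟_)
open import Data.Product using (∃; _×_)
open import Relation.Nullary using (yes; no; ¬_)
open import Relation.Binary.PropositionalEquality using (_≡_)

module _ where
  open Int using (_+_; _-_; _*_; -_)

  p₁ : ℤ → ℤ → ℤ → ℤ → ℤ
  p₁ S m x y =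
    S * S * S * S - (+ 2) * S * S * x * m + x * x * m * m - (+ 2) * S * S * S
    + (+ 2) * S * S * x - (+ 2) * S * x * m + (+ 2) * x * x * m + S * S
    - (+ 2) * S * x + x * x

  p₂ : ℤ → ℤ → ℤ → ℤ → ℤ
  p₂ S m x y =
    S * S * S * S + (+ 2) * S * S * x * m - (+ 4) * S * S * y * m + x * x * m * m
    - (+ 4) * x * y * m * m + (+ 4) * y * y * m * m - (+ 2) * S * S * S
    + (+ 2) * S * S * x + (+ 8) * S * S * m - (+ 6) * S * x * m - (+ 2) * x * x * m
    - (+ 4) * S * y * m + (+ 4) * x * y * m - (+ 4) * S * m * m + (+ 4) * x * m * m
    + S * S - (+ 2) * S * x + x * x

  p₃ : ℤ → ℤ → ℤ → ℤ → ℤ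
  p₃ S m x y =
    S * S * x * x - S * m * x * x - (+ 2) * S * S * x * y + (+ 2) * S * m * x * y
    + S * S * y * y - S * m * y * y + S * S * m + (+ 2) * S * S * x
    - (+ 2) * S * m * x - (+ 2) * S * x * x + m * x * x - (+ 2) * S * S * y
    + (+ 2) * S * x * y + S * S - (+ 2) * S * x + x * x

-- total division on ℚ (value irrelevant when the denominator is 0; the
-- theorem separately requires every denominator to be nonzero)
_÷₀_ : ℚ → ℚ → ℚ
p ÷₀ q with q ≟ 0ℚ
... | yes _ = 0ℚ
... | no q≢0 = _÷_ p q {{≢-nonZero q≢0}}

infixl 7 _÷₀_

ι : ℤ → ℚ
ι z = z Q./ 1

module Quantities (S' m' x' y' : ℤ) where
  open Q using (_+_; _-_; _*_)
  private
    S = ι S'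
    m = ι m'
    x = ι x'
    y = ι y'
    𝟙 = ι (+ 1)

  denΛ : ℚ
  denΛ = S * S * S * S - ι (+ 2) * S * S * S
         - ((x + y - 𝟙) * (m - 𝟙) - 𝟙) * S * S + x * y * m * (m - 𝟙)

  Λ : ℚ
  Λ = (S * (S - 𝟙) * (S - x) * (S - y)) ÷₀ denΛ

  T : ℚ
  T = ((m - 𝟙) * Λ) ÷₀ (S - 𝟙)

  N : ℚ
  N = (x * (m - S) * (S * (S - 𝟙) - y * (m - 𝟙)) * Λ)
      ÷₀ (S * (x - y) * (S - x) * (S - 𝟙))

  P : ℚ
  P = ((S * (S - 𝟙) - y * (m - 𝟙)) * Λ) ÷₀ ((x - y) * (S - 𝟙))

  r : ℚ
  r = (𝟙 ÷₀ (x - y)) * (((m - S) * Λ) ÷₀ (S - 𝟙) - (S - y))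

  k : ℚ
  k = ((m - S) * (S * (S - 𝟙) - y * (m - 𝟙)) * Λ)
      ÷₀ ((x - y) * (S - x) * (S - 𝟙))

  n : ℚ
  n = (m * T) ÷₀ S

  s : ℚ
  s = (y - S) ÷₀ (x - y)

  λ′ : ℚ
  λ′ = k + r + s + r * s

  Defined : Set
  Defined = ¬ denΛ ≡ 0ℚ × ¬ S - 𝟙 ≡ 0ℚ × ¬ S ≡ 0ℚ × ¬ x - y ≡ 0ℚ × ¬ S - x ≡ 0ℚ

IsInteger : ℚ → Set
IsInteger q = ∃ λ (z : ℤ) → q ≡ ι z

AllIntegral : ℤ → ℤ → ℤ → ℤ → Set
AllIntegral S m x y =
  Defined × IsInteger Λ × IsInteger T × IsInteger n × IsInteger k
  × IsInteger r × IsInteger s × IsInteger λ′ × IsInteger N × IsInteger P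
  where open Quantities S m x y

{-# OPTIONS --safe #-}
-- From p₁ = b² - (2S)²(S - x), b = xm - S² - S + x, the integer S - x is a square t², and then
-- xm = (S + t)².  Modulo these relations p₂ is 4m(x - y - t)(m(x - y + t) - 2St), and on the
-- second factor p₃ forces (m + 1)²t² + 4mt = m², impossible for m > 0 and t ≠ 0; so y = x - t.
-- For t = -1 this is curve (iii).  Otherwise a = t² + t > 0, and integrality of Λ, T, n and r
-- gives φ ∣ 4ax and φ ∣ 4a² for φ = 2a + (2x - a)(m + 1).  With γ = gcd(a, x), a = αγ and
-- x = βγ, this bounds |2α + (2β - α)(m + 1)| by 4a, while m ≥ 4a; that forces 2β = α unless
-- a ∈ {3, 10}, and neither is of the form t² + t.  So 2x = a: curve (i) with z = t.
-- Curve (ii) has S = x, where the quantities are undefined.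

module Submission where

open import Defs
open import Data.Empty using (⊥-elim)
open import Data.Fin using (Fin; zero; suc)
open import Data.Integer as ℤ using (ℤ; +_; -[1+_]; +[1+_]; _+_; _-_; _*_; -_; _≤_; _<_; _≥_; +≤+; +<+; -≤+; ∣_∣)
import Data.Integer.Properties as ℤ
open import Data.Integer.Divisibility.Signed as ℤ using (divides; ∣ᵤ⇒∣; ∣⇒∣ᵤ)
open import Data.Integer.GCD as ℤ using (gcd-zeroʳ)
open import Data.Integer.Tactic.RingSolver using (solve-∀)
open import Data.Nat as ℕ using (ℕ; zero; suc; NonZero; z≤n; s≤s)
import Data.Nat.Properties as ℕ
open import Data.Nat.Coprimality using (Coprime; coprime-/gcd; coprime-divisor)
open import Data.Nat.Divisibility as ℕ using (divides)
open import Data.Nat.DivMod using (_/_; m/n*n≡m)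
open import Data.Nat.GCD as ℕ using ()
open import Data.Nat.Tactic.RingSolver as ℕ using ()
open import Data.Product using (∃; _×_; _,_; proj₁; proj₂)
open import Data.Rational as ℚ using (ℚ; 0ℚ; 1ℚ; ↥_; ↧_; toℚᵘ; ≢-nonZero)
import Data.Rational.Properties as ℚ
open import Data.Rational.Solver using (module +-*-Solver)
open import Data.Rational.Unnormalised as ℚᵘ using (mkℚᵘ; *≡*)
import Data.Rational.Unnormalised.Properties as ℚᵘ
open import Data.Sum using (_⊎_; inj₁; inj₂; [_,_]′)
open import Data.Vec using (Vec; []; _∷_; lookup; map)
open import Data.Vec.Relation.Unary.All using (All; []; _∷_)
open import Data.Vec.Relation.Unary.All.Properties using (lookup⁺)
open import Function using (_∘_; _∘′_)
open import Relation.Nullary using (¬_; yes; no)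
open import Relation.Binary.PropositionalEquality

0≤+ : ∀ {n} → + 0 ≤ + n
0≤+ = +≤+ z≤n

0≤i*j : ∀ {i j} → + 0 ≤ i → + 0 ≤ j → + 0 ≤ i * j
0≤i*j {+ m} {+ n} _ _ = subst (+ 0 ≤_) (ℤ.pos-* m n) (+≤+ z≤n)

0≤i*i : ∀ i → + 0 ≤ i * i
0≤i*i (+ n)    = 0≤i*j (0≤+ {n}) 0≤+
0≤i*i -[1+ n ] = 0≤+

0<i*j : ∀ {i j} → + 0 < i → + 0 < j → + 0 < i * j
0<i*j {+[1+ m ]} {+[1+ n ]} _ _ = +<+ (s≤s z≤n)
0<i*j {+ zero} (+<+ ()) _
0<i*j {+[1+ m ]} {+ zero} _ (+<+ ())

i>0⇒i≢0 : ∀ {i} → + 0 < i → ¬ i ≡ + 0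
i>0⇒i≢0 0<i refl = ℤ.<-irrefl refl 0<i

i>0⇒i-1≥0 : ∀ {i} → + 0 < i → + 0 ≤ i - + 1
i>0⇒i-1≥0 {+[1+ n ]} _ = +≤+ z≤n
i>0⇒i-1≥0 {+ zero} (+<+ ())

0≤i∧i≢0⇒0<i : ∀ {i} → + 0 ≤ i → ¬ i ≡ + 0 → + 0 < i
0≤i∧i≢0⇒0<i {+ zero}  _ i≢0 = ⊥-elim (i≢0 refl)
0≤i∧i≢0⇒0<i {+[1+ n ]} _ _ = +<+ (s≤s z≤n)

0<i∧0≤i*j⇒0≤j : ∀ {i j} → + 0 < i → + 0 ≤ i * j → + 0 ≤ j
0<i∧0≤i*j⇒0≤j {+[1+ m ]} {+ n}      _ _ = +≤+ z≤n
0<i∧0≤i*j⇒0≤j {+[1+ m ]} { -[1+ n ]} _ ()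
0<i∧0≤i*j⇒0≤j {+ zero} (+<+ ()) _

0<i∧0<i*j⇒0<j : ∀ {i j} → + 0 < i → + 0 < i * j → + 0 < j
0<i∧0<i*j⇒0<j {+[1+ m ]} {+[1+ n ]} _ _ = +<+ (s≤s z≤n)
0<i∧0<i*j⇒0<j {+[1+ m ]} {+ zero} _ 0<i*0 = ⊥-elim (i>0⇒i≢0 0<i*0 (ℤ.*-zeroʳ +[1+ m ]))
0<i∧0<i*j⇒0<j {+[1+ m ]} { -[1+ n ]} _ ()
0<i∧0<i*j⇒0<j {+ zero} (+<+ ()) _

0≤i⇒i≢-1 : ∀ {i} → + 0 ≤ i → ¬ i ≡ - + 1
0≤i⇒i≢-1 (+≤+ _) ()

0≤i+j≢-1 : ∀ {i j} → + 0 ≤ i → + 0 ≤ j → ¬ i + j ≡ - + 1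
0≤i+j≢-1 0≤i 0≤j = 0≤i⇒i≢-1 (ℤ.+-mono-≤ 0≤i 0≤j)

∣i∣≤n⇒i≤n×-i≤n : ∀ i {n} → ∣ i ∣ ℕ.≤ n → i ≤ + n × - i ≤ + n
∣i∣≤n⇒i≤n×-i≤n (+ zero)  _ = 0≤+ , 0≤+
∣i∣≤n⇒i≤n×-i≤n +[1+ k ] ∣i∣≤n = +≤+ ∣i∣≤n , -≤+
∣i∣≤n⇒i≤n×-i≤n -[1+ k ] ∣i∣≤n = -≤+ , +≤+ ∣i∣≤n

i≢0⇒i*j≡0⇒j≡0 : ∀ {i j} → ¬ i ≡ + 0 → i * j ≡ + 0 → j ≡ + 0
i≢0⇒i*j≡0⇒j≡0 {i} i≢0 i*j≡0 with ℤ.i*j≡0⇒i≡0∨j≡0 i i*j≡0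
... | inj₁ i≡0 = ⊥-elim (i≢0 i≡0)
... | inj₂ j≡0 = j≡0

i≢0∧j≢0⇒i*j≢0 : ∀ {i j} → ¬ i ≡ + 0 → ¬ j ≡ + 0 → ¬ i * j ≡ + 0
i≢0∧j≢0⇒i*j≢0 {i} i≢0 j≢0 i*j≡0 = j≢0 (i≢0⇒i*j≡0⇒j≡0 i≢0 i*j≡0)

i≢0⇒i*[j-k]≡0⇒j≡k : ∀ {i j k} → ¬ i ≡ + 0 → i * (j - k) ≡ + 0 → j ≡ k
i≢0⇒i*[j-k]≡0⇒j≡k {j = j} {k} i≢0 = ℤ.i-j≡0⇒i≡j j k ∘′ i≢0⇒i*j≡0⇒j≡0 i≢0

combination₁ : ∀ c₁ {a₁ b₁} → a₁ ≡ b₁ → c₁ * (a₁ - b₁) ≡ + 0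
combination₁ c₁ {a₁} refl = trans (cong (c₁ *_) (ℤ.+-inverseʳ a₁)) (ℤ.*-zeroʳ c₁)

combination₂ : ∀ c₁ c₂ {a₁ b₁ a₂ b₂} → a₁ ≡ b₁ → a₂ ≡ b₂ →
               c₁ * (a₁ - b₁) + c₂ * (a₂ - b₂) ≡ + 0
combination₂ c₁ c₂ e₁ e₂ = cong₂ _+_ (combination₁ c₁ e₁) (combination₁ c₂ e₂)

combination₃ : ∀ c₁ c₂ c₃ {a₁ b₁ a₂ b₂ a₃ b₃} → a₁ ≡ b₁ → a₂ ≡ b₂ → a₃ ≡ b₃ →
               c₁ * (a₁ - b₁) + c₂ * (a₂ - b₂) + c₃ * (a₃ - b₃) ≡ + 0
combination₃ c₁ c₂ c₃ e₁ e₂ e₃ = cong₂ _+_ (combination₂ c₁ c₂ e₁ e₂) (combination₁ c₃ e₃)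

i-j≡-1⇒j≡i+1 : ∀ {i j} → i - j ≡ - + 1 → j ≡ i + + 1
i-j≡-1⇒j≡i+1 {i} {j} i-j≡-1 = ℤ.i-j≡0⇒i≡j j (i + + 1) (trans (certificate i j) (combination₁ (- + 1) i-j≡-1))
  where
  certificate : ∀ i j → j - (i + + 1) ≡ - + 1 * ((i - j) - - + 1)
  certificate = solve-∀

≥1⊎≡0⊎≡-1⊎≤-2 : ∀ e → + 0 ≤ e - + 1 ⊎ e ≡ + 0 ⊎ e ≡ - + 1 ⊎ + 0 ≤ - e - + 2
≥1⊎≡0⊎≡-1⊎≤-2 +[1+ n ]     = inj₁ 0≤+
≥1⊎≡0⊎≡-1⊎≤-2 (+ zero)     = inj₂ (inj₁ refl)
≥1⊎≡0⊎≡-1⊎≤-2 -[1+ zero ]  = inj₂ (inj₂ (inj₁ refl))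
≥1⊎≡0⊎≡-1⊎≤-2 -[1+ suc n ] = inj₂ (inj₂ (inj₂ 0≤+))

infixl 6 _⊞_
infixl 7 _⊠_

data ℕPoly (n : ℕ) : Set where
  con : ℕ → ℕPoly n
  var : Fin n → ℕPoly n
  _⊞_ _⊠_ : ℕPoly n → ℕPoly n → ℕPoly n

⟦_⟧⁺ : ∀ {n} → ℕPoly n → Vec ℤ n → ℤ
⟦ con c ⟧⁺ ρ = + c
⟦ var i ⟧⁺ ρ = lookup ρ i
⟦ e ⊞ f ⟧⁺ ρ = ⟦ e ⟧⁺ ρ + ⟦ f ⟧⁺ ρ
⟦ e ⊠ f ⟧⁺ ρ = ⟦ e ⟧⁺ ρ * ⟦ f ⟧⁺ ρ

0≤⟦⟧⁺ : ∀ {n} (e : ℕPoly n) {ρ : Vec ℤ n} → All (+ 0 ≤_) ρ → + 0 ≤ ⟦ e ⟧⁺ ρ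
0≤⟦⟧⁺ (con c) _   = 0≤+
0≤⟦⟧⁺ (var i) 0≤ρ = lookup⁺ 0≤ρ i
0≤⟦⟧⁺ (e ⊞ f) 0≤ρ = ℤ.+-mono-≤ (0≤⟦⟧⁺ e 0≤ρ) (0≤⟦⟧⁺ f 0≤ρ)
0≤⟦⟧⁺ (e ⊠ f) 0≤ρ = 0≤i*j (0≤⟦⟧⁺ e 0≤ρ) (0≤⟦⟧⁺ f 0≤ρ)

naturals : ∀ {n} (ns : Vec ℕ n) → All (+ 0 ≤_) (map +_ ns)
naturals []       = []
naturals (_ ∷ ns) = 0≤+ ∷ naturals ns

1+⟦⟧⁺>0 : ∀ {n} (e : ℕPoly n) {ρ : Vec ℤ n} → All (+ 0 ≤_) ρ → + 0 < + 1 + ⟦ e ⟧⁺ ρ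
1+⟦⟧⁺>0 e {ρ} 0≤ρ with ⟦ e ⟧⁺ ρ | 0≤⟦⟧⁺ e 0≤ρ
... | + n | _ = +<+ (s≤s z≤n)

↥-ι : ∀ z → ↥ ι z ≡ z
↥-ι z = begin
  ↥ ι z                 ≡⟨ ℤ.*-identityʳ (↥ ι z) ⟨
  ↥ ι z * + 1           ≡⟨ cong (↥ ι z *_) (gcd-zeroʳ z) ⟨
  ↥ ι z * ℤ.gcd z (+ 1) ≡⟨ ℚ.↥-/ z 1 ⟩
  z                     ∎
  where open ≡-Reasoning

↧-ι : ∀ z → ↧ ι z ≡ + 1
↧-ι z = begin
  ↧ ι z                 ≡⟨ ℤ.*-identityʳ (↧ ι z) ⟨
  ↧ ι z * + 1           ≡⟨ cong (↧ ι z *_) (gcd-zeroʳ z) ⟨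
  ↧ ι z * ℤ.gcd z (+ 1) ≡⟨ ℚ.↧-/ z 1 ⟩
  + 1                   ∎
  where open ≡-Reasoning

ι-injective : ∀ {a b} → ι a ≡ ι b → a ≡ b
ι-injective {a} {b} ιa≡ιb = trans (sym (↥-ι a)) (trans (cong ↥_ ιa≡ιb) (↥-ι b))

toℚᵘ-ι : ∀ z → toℚᵘ (ι z) ℚᵘ.≃ mkℚᵘ z 0
toℚᵘ-ι z = *≡* (cong₂ _*_ (trans (ℚ.↥ᵘ-toℚᵘ (ι z)) (↥-ι z))
                          (sym (trans (ℚ.↧ᵘ-toℚᵘ (ι z)) (↧-ι z))))

-- ι is a ring homomorphism: checked on unnormalised fractions, where z ↦ z/1 is one by computation.
ι-homo-+ : ∀ a b → ι (a + b) ≡ ι a ℚ.+ ι b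
ι-homo-+ a b = ℚ.toℚᵘ-injective (begin
  toℚᵘ (ι (a + b))                ≈⟨ toℚᵘ-ι (a + b) ⟩
  mkℚᵘ (a + b) 0                  ≈⟨ *≡* (cong (_* + 1) (cong₂ _+_ (ℤ.*-identityʳ a) (ℤ.*-identityʳ b))) ⟨
  mkℚᵘ a 0 ℚᵘ.+ mkℚᵘ b 0          ≈⟨ ℚᵘ.+-cong (toℚᵘ-ι a) (toℚᵘ-ι b) ⟨
  toℚᵘ (ι a) ℚᵘ.+ toℚᵘ (ι b)      ≈⟨ ℚ.toℚᵘ-homo-+ (ι a) (ι b) ⟨
  toℚᵘ (ι a ℚ.+ ι b)              ∎)
  where open ℚᵘ.≃-Reasoning

ι-homo-* : ∀ a b → ι (a * b) ≡ ι a ℚ.* ι b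
ι-homo-* a b = ℚ.toℚᵘ-injective (begin
  toℚᵘ (ι (a * b))                ≈⟨ toℚᵘ-ι (a * b) ⟩
  mkℚᵘ (a * b) 0                  ≈⟨ ℚᵘ.*-cong (toℚᵘ-ι a) (toℚᵘ-ι b) ⟨
  toℚᵘ (ι a) ℚᵘ.* toℚᵘ (ι b)      ≈⟨ ℚ.toℚᵘ-homo-* (ι a) (ι b) ⟨
  toℚᵘ (ι a ℚ.* ι b)              ∎)
  where open ℚᵘ.≃-Reasoning

ι-homo-‿- : ∀ a → ι (- a) ≡ ℚ.- ι a
ι-homo-‿- a = ℚ.toℚᵘ-injective (begin
  toℚᵘ (ι (- a))                  ≈⟨ toℚᵘ-ι (- a) ⟩
  mkℚᵘ (- a) 0                    ≈⟨ ℚᵘ.-‿cong (toℚᵘ-ι a) ⟨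
  ℚᵘ.- toℚᵘ (ι a)                 ≈⟨ ℚ.toℚᵘ-homo‿- (ι a) ⟨
  toℚᵘ (ℚ.- ι a)                  ∎)
  where open ℚᵘ.≃-Reasoning

ι-homo-− : ∀ a b → ι (a - b) ≡ ι a ℚ.- ι b
ι-homo-− a b = trans (ι-homo-+ a (- b)) (cong (ι a ℚ.+_) (ι-homo-‿- b))

÷₀-cancelʳ : ∀ p {q} → ¬ q ≡ 0ℚ → (p ÷₀ q) ℚ.* q ≡ p
÷₀-cancelʳ p {q} q≢0 with q ℚ.≟ 0ℚ
... | yes q≡0 = ⊥-elim (q≢0 q≡0)
... | no q≢0′ = begin
  p ℚ.* ℚ.1/ q ℚ.* q       ≡⟨ ℚ.*-assoc p (ℚ.1/ q) q ⟩
  p ℚ.* (ℚ.1/ q ℚ.* q)     ≡⟨ cong (p ℚ.*_) (ℚ.*-inverseˡ q) ⟩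
  p ℚ.* 1ℚ                 ≡⟨ ℚ.*-identityʳ p ⟩
  p                        ∎
  where
  open ≡-Reasoning
  instance _ = ≢-nonZero q≢0′

-- Integer polynomial expressions, read in ℤ and, through ι, in ℚ; the denominators and numerators
-- of Quantities are definitionally ⟦_⟧ℚ of such expressions (e.g. ⟦ denΛᴱ S m x y ⟧ℚ is denΛ).
infixl 6 _⊕_ _⊖_
infixl 7 _⊗_

data Expr : Set where
  ⌜_⌝ : ℤ → Expr
  _⊕_ _⊖_ _⊗_ : Expr → Expr → Expr

⟦_⟧ℤ : Expr → ℤ
⟦ ⌜ z ⌝ ⟧ℤ = z
⟦ e ⊕ f ⟧ℤ = ⟦ e ⟧ℤ + ⟦ f ⟧ℤ
⟦ e ⊖ f ⟧ℤ = ⟦ e ⟧ℤ - ⟦ f ⟧ℤ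
⟦ e ⊗ f ⟧ℤ = ⟦ e ⟧ℤ * ⟦ f ⟧ℤ

⟦_⟧ℚ : Expr → ℚ
⟦ ⌜ z ⌝ ⟧ℚ = ι z
⟦ e ⊕ f ⟧ℚ = ⟦ e ⟧ℚ ℚ.+ ⟦ f ⟧ℚ
⟦ e ⊖ f ⟧ℚ = ⟦ e ⟧ℚ ℚ.- ⟦ f ⟧ℚ
⟦ e ⊗ f ⟧ℚ = ⟦ e ⟧ℚ ℚ.* ⟦ f ⟧ℚ

⟦⟧ℚ≡ι⟦⟧ℤ : ∀ e → ⟦ e ⟧ℚ ≡ ι ⟦ e ⟧ℤ
⟦⟧ℚ≡ι⟦⟧ℤ ⌜ z ⌝   = refl
⟦⟧ℚ≡ι⟦⟧ℤ (e ⊕ f) = trans (cong₂ ℚ._+_ (⟦⟧ℚ≡ι⟦⟧ℤ e) (⟦⟧ℚ≡ι⟦⟧ℤ f)) (sym (ι-homo-+ ⟦ e ⟧ℤ ⟦ f ⟧ℤ))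
⟦⟧ℚ≡ι⟦⟧ℤ (e ⊖ f) = trans (cong₂ ℚ._-_ (⟦⟧ℚ≡ι⟦⟧ℤ e) (⟦⟧ℚ≡ι⟦⟧ℤ f)) (sym (ι-homo-− ⟦ e ⟧ℤ ⟦ f ⟧ℤ))
⟦⟧ℚ≡ι⟦⟧ℤ (e ⊗ f) = trans (cong₂ ℚ._*_ (⟦⟧ℚ≡ι⟦⟧ℤ e) (⟦⟧ℚ≡ι⟦⟧ℤ f)) (sym (ι-homo-* ⟦ e ⟧ℤ ⟦ f ⟧ℤ))

⟦⟧ℚ≢0⇒⟦⟧ℤ≢0 : ∀ e → ¬ ⟦ e ⟧ℚ ≡ 0ℚ → ¬ ⟦ e ⟧ℤ ≡ + 0
⟦⟧ℚ≢0⇒⟦⟧ℤ≢0 e ⟦e⟧ℚ≢0 ⟦e⟧ℤ≡0 = ⟦e⟧ℚ≢0 (trans (⟦⟧ℚ≡ι⟦⟧ℤ e) (cong ι ⟦e⟧ℤ≡0))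

÷₀-integral : ∀ {p} num den {z} → p ≡ ⟦ num ⟧ℚ → ¬ ⟦ den ⟧ℚ ≡ 0ℚ →
              p ÷₀ ⟦ den ⟧ℚ ≡ ι z → z * ⟦ den ⟧ℤ ≡ ⟦ num ⟧ℤ
÷₀-integral {p} num den {z} p≡num den≢0 p/den≡z = ι-injective (begin
  ι (z * ⟦ den ⟧ℤ)           ≡⟨ ι-homo-* z ⟦ den ⟧ℤ ⟩
  ι z ℚ.* ι ⟦ den ⟧ℤ          ≡⟨ cong₂ ℚ._*_ p/den≡z (⟦⟧ℚ≡ι⟦⟧ℤ den) ⟨
  (p ÷₀ ⟦ den ⟧ℚ) ℚ.* ⟦ den ⟧ℚ ≡⟨ ÷₀-cancelʳ p den≢0 ⟩
  p                          ≡⟨ p≡num ⟩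
  ⟦ num ⟧ℚ                   ≡⟨ ⟦⟧ℚ≡ι⟦⟧ℤ num ⟩
  ι ⟦ num ⟧ℤ                 ∎)
  where open ≡-Reasoning

module _ (S m x y : ℤ) where

  denΛᴱ : Expr
  denΛᴱ = ⌜ S ⌝ ⊗ ⌜ S ⌝ ⊗ ⌜ S ⌝ ⊗ ⌜ S ⌝ ⊖ ⌜ + 2 ⌝ ⊗ ⌜ S ⌝ ⊗ ⌜ S ⌝ ⊗ ⌜ S ⌝
          ⊖ ((⌜ x ⌝ ⊕ ⌜ y ⌝ ⊖ ⌜ + 1 ⌝) ⊗ (⌜ m ⌝ ⊖ ⌜ + 1 ⌝) ⊖ ⌜ + 1 ⌝) ⊗ ⌜ S ⌝ ⊗ ⌜ S ⌝
          ⊕ ⌜ x ⌝ ⊗ ⌜ y ⌝ ⊗ ⌜ m ⌝ ⊗ (⌜ m ⌝ ⊖ ⌜ + 1 ⌝)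

  numΛᴱ : Expr
  numΛᴱ = ⌜ S ⌝ ⊗ (⌜ S ⌝ ⊖ ⌜ + 1 ⌝) ⊗ (⌜ S ⌝ ⊖ ⌜ x ⌝) ⊗ (⌜ S ⌝ ⊖ ⌜ y ⌝)

record IntegralityEquations (S m x y : ℤ) : Set where
  field
    S-1≢0 : ¬ S - + 1 ≡ + 0
    S-x≢0 : ¬ S - x ≡ + 0
    Λ T n r : ℤ
    Λ-eq : Λ * ⟦ denΛᴱ S m x y ⟧ℤ ≡ ⟦ numΛᴱ S m x y ⟧ℤ
    T-eq : T * (S - + 1) ≡ (m - + 1) * Λ
    n-eq : n * S ≡ m * T
    r-eq : (r * (x - y) + (S - y)) * (S - + 1) ≡ (m - S) * Λ

integralityEquations : ∀ S m x y → AllIntegral S m x y → IntegralityEquations S m x y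
integralityEquations S m x y
  ((denΛ≢0 , S-1≢0 , S≢0 , x-y≢0 , S-x≢0) , (Λ , Λ≡) , (T , T≡) , (n , n≡) , _ , (r , r≡) , _) = record
  { S-1≢0 = ⟦⟧ℚ≢0⇒⟦⟧ℤ≢0 (⌜ S ⌝ ⊖ ⌜ + 1 ⌝) S-1≢0
  ; S-x≢0 = ⟦⟧ℚ≢0⇒⟦⟧ℤ≢0 (⌜ S ⌝ ⊖ ⌜ x ⌝) S-x≢0
  ; Λ = Λ ; T = T ; n = n ; r = r
  ; Λ-eq = ÷₀-integral (numΛᴱ S m x y) (denΛᴱ S m x y) {Λ} refl denΛ≢0 Λ≡
  ; T-eq = ÷₀-integral ((⌜ m ⌝ ⊖ ⌜ + 1 ⌝) ⊗ ⌜ Λ ⌝) (⌜ S ⌝ ⊖ ⌜ + 1 ⌝) {T} (cong ((ι m ℚ.- ι (+ 1)) ℚ.*_) Λ≡) S-1≢0 T≡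
  ; n-eq = ÷₀-integral (⌜ m ⌝ ⊗ ⌜ T ⌝) ⌜ S ⌝ {n} (cong (ι m ℚ.*_) T≡) S≢0 n≡
  ; r-eq = ι-injective (begin
      ι ((r * (x - y) + (S - y)) * (S - + 1))     ≡⟨ ⟦⟧ℚ≡ι⟦⟧ℤ ((⌜ r ⌝ ⊗ (⌜ x ⌝ ⊖ ⌜ y ⌝) ⊕ (⌜ S ⌝ ⊖ ⌜ y ⌝)) ⊗ (⌜ S ⌝ ⊖ ⌜ + 1 ⌝)) ⟨
      (ι r ℚ.* X ℚ.+ D) ℚ.* (ι S ℚ.- ι (+ 1))      ≡⟨ cong (ℚ._* (ι S ℚ.- ι (+ 1))) r*X+D≡A ⟩
      A ℚ.* (ι S ℚ.- ι (+ 1))                      ≡⟨ ÷₀-cancelʳ _ S-1≢0 ⟩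
      (ι m ℚ.- ι S) ℚ.* Quantities.Λ S m x y       ≡⟨ cong ((ι m ℚ.- ι S) ℚ.*_) Λ≡ ⟩
      ⟦ (⌜ m ⌝ ⊖ ⌜ S ⌝) ⊗ ⌜ Λ ⌝ ⟧ℚ                 ≡⟨ ⟦⟧ℚ≡ι⟦⟧ℤ ((⌜ m ⌝ ⊖ ⌜ S ⌝) ⊗ ⌜ Λ ⌝) ⟩
      ι ((m - S) * Λ)                              ∎)
  }
  where
  open ≡-Reasoning
  open +-*-Solver
  X D A u : ℚ
  X = ι x ℚ.- ι y
  D = ι S ℚ.- ι y
  A = ((ι m ℚ.- ι S) ℚ.* Quantities.Λ S m x y) ÷₀ (ι S ℚ.- ι (+ 1))
  u = ι (+ 1) ÷₀ X
  r*X+D≡A : ι r ℚ.* X ℚ.+ D ≡ A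
  r*X+D≡A = begin
    ι r ℚ.* X ℚ.+ D                  ≡⟨ cong (λ q → q ℚ.* X ℚ.+ D) r≡ ⟨
    u ℚ.* (A ℚ.- D) ℚ.* X ℚ.+ D      ≡⟨ solve 4 (λ u c X D → u :* c :* X :+ D := c :* (u :* X) :+ D) refl u (A ℚ.- D) X D ⟩
    (A ℚ.- D) ℚ.* (u ℚ.* X) ℚ.+ D    ≡⟨ cong (λ q → (A ℚ.- D) ℚ.* q ℚ.+ D) (÷₀-cancelʳ (ι (+ 1)) x-y≢0) ⟩
    (A ℚ.- D) ℚ.* 1ℚ ℚ.+ D           ≡⟨ solve 2 (λ A D → (A :- D) :* con 1ℚ :+ D := A) refl A D ⟩
    A                                ∎

record CoprimeSplit (m n : ℕ) : Set where
  field
    g m′ n′ : ℕ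
    g≢0 : NonZero g
    m≡m′*g : m ≡ m′ ℕ.* g
    n≡n′*g : n ≡ n′ ℕ.* g
    coprime : Coprime m′ n′

coprimeSplit : ∀ m n .{{_ : NonZero m}} → CoprimeSplit m n
coprimeSplit m n = record
  { g = ℕ.gcd m n ; m′ = m / ℕ.gcd m n ; n′ = n / ℕ.gcd m n ; g≢0 = gcd≢0
  ; m≡m′*g = sym (m/n*n≡m (ℕ.gcd[m,n]∣m m n))
  ; n≡n′*g = sym (m/n*n≡m (ℕ.gcd[m,n]∣n m n))
  ; coprime = coprime-/gcd m n }
  where
  gcd≢0 : NonZero (ℕ.gcd m n)
  gcd≢0 = ℕ.≢-nonZero (ℕ.gcd[m,n]≢0 m n (inj₁ (ℕ.≢-nonZero⁻¹ m)))
  instance _ = gcd≢0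

m*m∣n*n⇒m∣n : ∀ m n → m ℕ.* m ℕ.∣ n ℕ.* n → m ℕ.∣ n
m*m∣n*n⇒m∣n zero n 0∣n*n with ℕ.m*n≡0⇒m≡0∨n≡0 n (ℕ.0∣⇒≡0 0∣n*n)
... | inj₁ refl = ℕ.∣-refl
... | inj₂ refl = ℕ.∣-refl
m*m∣n*n⇒m∣n m@(suc _) n m*m∣n*n = subst₂ ℕ._∣_ (sym m≡m′*g) (sym n≡n′*g) (ℕ.*-monoˡ-∣ g m′∣n′)
  where
  open CoprimeSplit (coprimeSplit m n)
  squares : ∀ a g → (a ℕ.* g) ℕ.* (a ℕ.* g) ≡ (a ℕ.* a) ℕ.* (g ℕ.* g)
  squares = ℕ.solve-∀
  instance _ = g≢0
  instance _ = ℕ.m*n≢0 g g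
  m′*m′∣n′*n′ : m′ ℕ.* m′ ℕ.∣ n′ ℕ.* n′
  m′*m′∣n′*n′ = ℕ.*-cancelʳ-∣ (g ℕ.* g) (subst₂ ℕ._∣_
    (trans (cong₂ ℕ._*_ m≡m′*g m≡m′*g) (squares m′ g))
    (trans (cong₂ ℕ._*_ n≡n′*g n≡n′*g) (squares n′ g)) m*m∣n*n)
  m′∣n′ : m′ ℕ.∣ n′
  m′∣n′ = coprime-divisor coprime (ℕ.∣-trans (ℕ.m∣m*n m′) m′*m′∣n′*n′)

b*b≡c*c*u⇒u≡t*t : ∀ c b u → ¬ c ≡ + 0 → b * b ≡ c * c * u → ∃ λ t → b ≡ t * c × u ≡ t * t
b*b≡c*c*u⇒u≡t*t c b u c≢0 b²≡c²u = t , b≡t*c , u≡t*t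
  where
  ∣c∣∣∣b∣ : ∣ c ∣ ℕ.∣ ∣ b ∣
  ∣c∣∣∣b∣ = m*m∣n*n⇒m∣n ∣ c ∣ ∣ b ∣ (divides ∣ u ∣ (begin
    ∣ b ∣ ℕ.* ∣ b ∣       ≡⟨ ℤ.abs-* b b ⟨
    ∣ b * b ∣             ≡⟨ cong ∣_∣ b²≡c²u ⟩
    ∣ c * c * u ∣         ≡⟨ ℤ.abs-* (c * c) u ⟩
    ∣ c * c ∣ ℕ.* ∣ u ∣   ≡⟨ ℕ.*-comm ∣ c * c ∣ ∣ u ∣ ⟩
    ∣ u ∣ ℕ.* ∣ c * c ∣   ≡⟨ cong (∣ u ∣ ℕ.*_) (ℤ.abs-* c c) ⟩
    ∣ u ∣ ℕ.* (∣ c ∣ ℕ.* ∣ c ∣) ∎))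
    where open ≡-Reasoning
  open ℤ._∣_ (∣ᵤ⇒∣ {c} {b} ∣c∣∣∣b∣) renaming (quotient to t; equality to b≡t*c)
  instance _ = ℤ.i*j≢0 c c {{ℤ.≢-nonZero c≢0}} {{ℤ.≢-nonZero c≢0}}
  squares : ∀ c t → c * c * (t * t) ≡ (t * c) * (t * c)
  squares = solve-∀
  u≡t*t : u ≡ t * t
  u≡t*t = ℤ.*-cancelˡ-≡ (c * c) u (t * t) (begin
    c * c * u             ≡⟨ b²≡c²u ⟨
    b * b                 ≡⟨ cong₂ _*_ b≡t*c b≡t*c ⟩
    (t * c) * (t * c)     ≡⟨ squares c t ⟨
    c * c * (t * t)       ∎)
    where open ≡-Reasoning

quartic≢0 : ∀ m t → + 0 < m → ¬ t ≡ + 0 →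
            ¬ (m + + 1) * (m + + 1) * t * t + + 4 * m * t - m * m ≡ + 0
quartic≢0 (+ zero) _ (+<+ ())
quartic≢0 +[1+ p ] +[1+ q ] _ _ =
  i>0⇒i≢0 (subst (+ 0 <_) (sym (certificate (+ p) (+ q))) (1+⟦⟧⁺>0 E (naturals (p ∷ q ∷ []))))
  where
  M K : ℕPoly 2
  M = var zero
  K = var (suc zero)
  E : ℕPoly 2
  E = con 6 ⊠ (con 1 ⊞ M) ⊞ (con 2 ⊞ M) ⊠ (con 2 ⊞ M) ⊠ K ⊠ (con 2 ⊞ K) ⊞ con 4 ⊠ (con 1 ⊞ M) ⊠ K
  certificate : ∀ M K → let m = + 1 + M ; t = + 1 + K in
    (m + + 1) * (m + + 1) * t * t + + 4 * m * t - m * m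
      ≡ + 1 + (+ 6 * (+ 1 + M) + (+ 2 + M) * (+ 2 + M) * K * (+ 2 + K) + + 4 * (+ 1 + M) * K)
  certificate = solve-∀
quartic≢0 +[1+ p ] (+ zero) _ t≢0 _ = t≢0 refl
quartic≢0 +[1+ p ] -[1+ zero ] _ _ quartic≡0 =
  0≤i⇒i≢-1 (0≤⟦⟧⁺ E (naturals (p ∷ []))) (trans (certificate (+ p)) (cong (λ q → - + 1 - q) quartic≡0))
  where
  E : ℕPoly 1
  E = con 2 ⊠ var zero
  certificate : ∀ M → let m = + 1 + M ; t = - + 1 in
    + 2 * M ≡ - + 1 - ((m + + 1) * (m + + 1) * t * t + + 4 * m * t - m * m)
  certificate = solve-∀
quartic≢0 +[1+ p ] -[1+ suc q ] _ _ =
  i>0⇒i≢0 (subst (+ 0 <_) (sym (certificate (+ p) (+ q))) (1+⟦⟧⁺>0 E (naturals (p ∷ q ∷ []))))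
  where
  M K : ℕPoly 2
  M = var zero
  K = var (suc zero)
  E : ℕPoly 2
  E = con 3 ⊞ con 3 ⊠ (con 1 ⊞ M) ⊠ (con 1 ⊞ M) ⊞ con 4 ⊠ K ⊠ (con 1 ⊞ M) ⊠ (con 1 ⊞ M)
      ⊞ con 4 ⊠ K ⊠ (con 1 ⊞ M) ⊞ con 4 ⊠ K ⊞ K ⊠ K ⊠ (con 2 ⊞ M) ⊠ (con 2 ⊞ M)
  certificate : ∀ M K → let m = + 1 + M ; t = - (+ 2 + K) in
    (m + + 1) * (m + + 1) * t * t + + 4 * m * t - m * m
      ≡ + 1 + (+ 3 + + 3 * (+ 1 + M) * (+ 1 + M) + + 4 * K * (+ 1 + M) * (+ 1 + M) + + 4 * K * (+ 1 + M)
               + + 4 * K + K * K * (+ 2 + M) * (+ 2 + M))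
  certificate = solve-∀

t*t+t>0 : ∀ t → ¬ t ≡ + 0 → ¬ t ≡ - + 1 → + 0 < t * t + t
t*t+t>0 (+ zero)         t≢0 _ = ⊥-elim (t≢0 refl)
t*t+t>0 -[1+ zero ]      _ t≢-1 = ⊥-elim (t≢-1 refl)
t*t+t>0 +[1+ n ]         _ _ = subst (+ 0 <_) (sym (certificate (+ n))) (1+⟦⟧⁺>0 E (naturals (n ∷ [])))
  where
  E : ℕPoly 1
  E = con 1 ⊞ con 3 ⊠ var zero ⊞ var zero ⊠ var zero
  certificate : ∀ N → let t = + 1 + N in t * t + t ≡ + 1 + (+ 1 + + 3 * N + N * N)
  certificate = solve-∀
t*t+t>0 -[1+ suc n ]     _ _ = subst (+ 0 <_) (sym (certificate (+ n))) (1+⟦⟧⁺>0 E (naturals (n ∷ [])))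
  where
  E : ℕPoly 1
  E = con 1 ⊞ con 3 ⊠ var zero ⊞ var zero ⊠ var zero
  certificate : ∀ N → let t = - (+ 2 + N) in t * t + t ≡ + 1 + (+ 1 + + 3 * N + N * N)
  certificate = solve-∀

v≡12+i⇒v≢3,10 : ∀ {v i} → + 0 ≤ i → v ≡ + 12 + i → ¬ v ≡ + 3 × ¬ v ≡ + 10
v≡12+i⇒v≢3,10 (+≤+ _) refl = (λ ()) , (λ ())

t*t+t≢3,10 : ∀ t → ¬ t * t + t ≡ + 3 × ¬ t * t + t ≡ + 10
t*t+t≢3,10 (+ 0)        = (λ ()) , (λ ())
t*t+t≢3,10 (+ 1)        = (λ ()) , (λ ())
t*t+t≢3,10 (+ 2)        = (λ ()) , (λ ())
t*t+t≢3,10 -[1+ 0 ]     = (λ ()) , (λ ())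
t*t+t≢3,10 -[1+ 1 ]     = (λ ()) , (λ ())
t*t+t≢3,10 -[1+ 2 ]     = (λ ()) , (λ ())
t*t+t≢3,10 (+ suc (suc (suc n))) = v≡12+i⇒v≢3,10 (0≤⟦⟧⁺ E (naturals (n ∷ []))) (certificate (+ n))
  where
  E : ℕPoly 1
  E = con 7 ⊠ var zero ⊞ var zero ⊠ var zero
  certificate : ∀ N → let t = + 3 + N in t * t + t ≡ + 12 + (+ 7 * N + N * N)
  certificate = solve-∀
t*t+t≢3,10 -[1+ suc (suc (suc n)) ] = v≡12+i⇒v≢3,10 (0≤⟦⟧⁺ E (naturals (n ∷ []))) (certificate (+ n))
  where
  E : ℕPoly 1
  E = con 7 ⊠ var zero ⊞ var zero ⊠ var zero
  certificate : ∀ N → let t = - (+ 4 + N) in t * t + t ≡ + 12 + (+ 7 * N + N * N)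
  certificate = solve-∀

c[b+1]²≤4b+1⇒c≡1∧b≤2 : ∀ b c → + 0 < b → + 0 < c → + 0 ≤ + 4 * b + + 1 - c * ((b + + 1) * (b + + 1)) →
               c ≡ + 1 × (b ≡ + 1 ⊎ b ≡ + 2)
c[b+1]²≤4b+1⇒c≡1∧b≤2 (+ zero) _ (+<+ ()) _ _
c[b+1]²≤4b+1⇒c≡1∧b≤2 _ (+ zero) _ (+<+ ()) _
c[b+1]²≤4b+1⇒c≡1∧b≤2 (+ 1) (+ 1) _ _ _ = refl , inj₁ refl
c[b+1]²≤4b+1⇒c≡1∧b≤2 (+ 2) (+ 1) _ _ _ = refl , inj₂ refl
c[b+1]²≤4b+1⇒c≡1∧b≤2 +[1+ suc (suc b) ] (+ 1) _ _ 0≤v =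
  ⊥-elim (0≤i+j≢-1 0≤v (0≤⟦⟧⁺ E (naturals (b ∷ []))) (certificate (+ b)))
  where
  E : ℕPoly 1
  E = con 2 ⊞ con 4 ⊠ var zero ⊞ var zero ⊠ var zero
  certificate : ∀ B → let b = + 3 + B in
    + 4 * b + + 1 - + 1 * ((b + + 1) * (b + + 1)) + (+ 2 + + 4 * B + B * B) ≡ - + 1
  certificate = solve-∀
c[b+1]²≤4b+1⇒c≡1∧b≤2 +[1+ b ] +[1+ suc c ] _ _ 0≤v =
  ⊥-elim (0≤i+j≢-1 0≤v (0≤⟦⟧⁺ E (naturals (b ∷ c ∷ []))) (certificate (+ b) (+ c)))
  where
  B C : ℕPoly 2
  B = var zero
  C = var (suc zero)
  E : ℕPoly 2
  E = con 2 ⊞ con 4 ⊠ B ⊞ con 2 ⊠ B ⊠ B ⊞ C ⊠ (con 2 ⊞ B) ⊠ (con 2 ⊞ B)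
  certificate : ∀ B C → let b = + 1 + B ; c = + 2 + C in
    + 4 * b + + 1 - c * ((b + + 1) * (b + + 1)) + (+ 2 + + 4 * B + + 2 * B * B + C * (+ 2 + B) * (+ 2 + B)) ≡ - + 1
  certificate = solve-∀

φ : ℤ → ℤ → ℤ → ℤ
φ a x m = + 2 * a + (+ 2 * x - a) * (m + + 1)

x*m≡[x+a]²⇒4a≤m : ∀ {x a m} → + 0 < x → x * m ≡ (x + a) * (x + a) → + 0 ≤ m - + 4 * a
x*m≡[x+a]²⇒4a≤m {x} {a} {m} 0<x x*m≡[x+a]² =
  0<i∧0≤i*j⇒0≤j 0<x (subst (+ 0 ≤_) (sym x[m-4a]≡[x-a]²) (0≤i*i (x - a)))
  where
  certificate : ∀ x a m → x * (m - + 4 * a) ≡ (x - a) * (x - a) + + 1 * (x * m - (x + a) * (x + a))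
  certificate = solve-∀
  x[m-4a]≡[x-a]² : x * (m - + 4 * a) ≡ (x - a) * (x - a)
  x[m-4a]≡[x-a]² = trans (certificate x a m)
    (trans (cong (_+_ ((x - a) * (x - a))) (combination₁ (+ 1) x*m≡[x+a]²)) (ℤ.+-identityʳ _))

2β+1-φ-bound⇒αγ≡3⊎10 : ∀ β γ m → + 0 < β → + 0 < γ → let α = + 2 * β + + 1 in
               β * γ * m ≡ (β * γ + α * γ) * (β * γ + α * γ) → - φ α β m ≤ + 4 * (α * γ) →
               α * γ ≡ + 3 ⊎ α * γ ≡ + 10
2β+1-φ-bound⇒αγ≡3⊎10 β γ m 0<β 0<γ ρ -φ≤4a = conclude (c[b+1]²≤4b+1⇒c≡1∧b≤2 β c 0<β 0<c 0≤4β+1-c[β+1]²)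
  where
  α c : ℤ
  α = + 2 * β + + 1
  -- βm = γ(3β + 1)², and c = m - γ(9β + 6) is the quotient γ / β
  c = m - γ * (+ 9 * β + + 6)
  γ≡βc : γ ≡ β * c
  γ≡βc = sym (i≢0⇒i*[j-k]≡0⇒j≡k (i>0⇒i≢0 0<γ) (trans (certificate β γ m) (combination₁ (+ 1) ρ)))
    where
    certificate : ∀ β γ m → let α = + 2 * β + + 1 ; c = m - γ * (+ 9 * β + + 6) in
      γ * (β * c - γ) ≡ + 1 * (β * γ * m - (β * γ + α * γ) * (β * γ + α * γ))
    certificate = solve-∀
  0<c : + 0 < c
  0<c = 0<i∧0<i*j⇒0<j 0<β (subst (+ 0 <_) γ≡βc 0<γ)
  0≤4β+1-c[β+1]² : + 0 ≤ + 4 * β + + 1 - c * ((β + + 1) * (β + + 1))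
  0≤4β+1-c[β+1]² = subst (+ 0 ≤_) (sym (trans (certificate β γ m)
      (trans (cong (_+_ (+ 4 * (α * γ) - - φ α β m)) (combination₁ (β + + 2) γ≡βc)) (ℤ.+-identityʳ _))))
    (ℤ.i≤j⇒0≤j-i -φ≤4a)
    where
    certificate : ∀ β γ m →
      let α = + 2 * β + + 1
          c = m - γ * (+ 9 * β + + 6)
          φ = + 2 * α + (+ 2 * β - α) * (m + + 1)
      in + 4 * β + + 1 - c * ((β + + 1) * (β + + 1)) ≡ (+ 4 * (α * γ) - - φ) + (β + + 2) * (γ - β * c)
    certificate = solve-∀
  a≡αβc : α * γ ≡ α * (β * c)
  a≡αβc = cong (α *_) γ≡βc
  conclude : c ≡ + 1 × (β ≡ + 1 ⊎ β ≡ + 2) → α * γ ≡ + 3 ⊎ α * γ ≡ + 10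
  conclude (c≡1 , inj₁ β≡1) = inj₁ (trans a≡αβc (cong₂ (λ b c → (+ 2 * b + + 1) * (b * c)) β≡1 c≡1))
  conclude (c≡1 , inj₂ β≡2) = inj₂ (trans a≡αβc (cong₂ (λ b c → (+ 2 * b + + 1) * (b * c)) β≡2 c≡1))

-- With e = 2β - α, e ≥ 1 gives φ > m ≥ 4αγ and e ≤ -2 gives -φ > 4αγ.
φ-bound⇒2β≡α : ∀ α β γ m → + 0 < α → + 0 < β → + 0 < γ →
               β * γ * m ≡ (β * γ + α * γ) * (β * γ + α * γ) →
               φ α β m ≤ + 4 * (α * γ) → - φ α β m ≤ + 4 * (α * γ) →
               ¬ α * γ ≡ + 3 → ¬ α * γ ≡ + 10 → + 2 * β ≡ α
φ-bound⇒2β≡α α β γ m 0<α 0<β 0<γ ρ φ≤4a -φ≤4a a≢3 a≢10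
  with x*m≡[x+a]²⇒4a≤m (0<i*j 0<β 0<γ) ρ | ≥1⊎≡0⊎≡-1⊎≤-2 (+ 2 * β - α)
... | _ | inj₂ (inj₁ e≡0) = ℤ.i-j≡0⇒i≡j (+ 2 * β) α e≡0
... | 0≤m-4a | inj₁ 0≤e-1 =
  ⊥-elim (0≤i+j≢-1 (ℤ.i≤j⇒0≤j-i φ≤4a) (0≤⟦⟧⁺ E (ℤ.<⇒≤ 0<α ∷ ℤ.<⇒≤ 0<γ ∷ 0≤m-4a ∷ 0≤e-1 ∷ []))
                   (certificate α β γ m))
  where
  A G M E₁ : ℕPoly 4
  A = var zero
  G = var (suc zero)
  M = var (suc (suc zero))
  E₁ = var (suc (suc (suc zero)))
  E : ℕPoly 4
  E = con 2 ⊠ A ⊞ E₁ ⊠ (M ⊞ con 4 ⊠ A ⊠ G ⊞ con 1) ⊞ M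
  certificate : ∀ α β γ m →
    let a = α * γ
        e = + 2 * β - α
        φ = + 2 * α + e * (m + + 1)
    in (+ 4 * a - φ) + (+ 2 * α + (e - + 1) * ((m - + 4 * a) + + 4 * α * γ + + 1) + (m - + 4 * a)) ≡ - + 1
  certificate = solve-∀
... | 0≤m-4a | inj₂ (inj₂ (inj₂ 0≤-e-2)) =
  ⊥-elim (0≤i+j≢-1 (ℤ.i≤j⇒0≤j-i -φ≤4a) (0≤⟦⟧⁺ E (ℤ.<⇒≤ 0<α ∷ i>0⇒i-1≥0 0<γ ∷ 0≤m-4a ∷ 0≤-e-2 ∷ []))
                   (certificate α β γ m))
  where
  A G₁ M E₂ : ℕPoly 4
  A = var zero
  G₁ = var (suc zero)
  M = var (suc (suc zero))
  E₂ = var (suc (suc (suc zero)))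
  E : ℕPoly 4
  E = E₂ ⊠ (M ⊞ con 4 ⊠ A ⊠ (G₁ ⊞ con 1) ⊞ con 1) ⊞ con 2 ⊠ M ⊞ con 2 ⊠ A ⊠ G₁
      ⊞ con 2 ⊠ A ⊠ (G₁ ⊞ con 1) ⊞ con 1
  certificate : ∀ α β γ m →
    let a = α * γ
        e = + 2 * β - α
        φ = + 2 * α + e * (m + + 1)
    in (+ 4 * a - - φ)
       + ((- e - + 2) * ((m - + 4 * a) + + 4 * α * ((γ - + 1) + + 1) + + 1) + + 2 * (m - + 4 * a)
          + + 2 * α * (γ - + 1) + + 2 * α * ((γ - + 1) + + 1) + + 1)
       ≡ - + 1
  certificate = solve-∀
... | _ | inj₂ (inj₂ (inj₁ e≡-1)) with i-j≡-1⇒j≡i+1 {+ 2 * β} {α} e≡-1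
...   | refl = ⊥-elim ([ a≢3 , a≢10 ]′ (2β+1-φ-bound⇒αγ≡3⊎10 β γ m 0<β 0<γ ρ -φ≤4a))

φ∣4ax∧φ∣4aa⇒2x≡a : ∀ a x m → + 0 < a → + 0 < x → ¬ a ≡ + 3 → ¬ a ≡ + 10 → x * m ≡ (x + a) * (x + a) →
       φ a x m ℤ.∣ + 4 * a * x → φ a x m ℤ.∣ + 4 * a * a → + 2 * x ≡ a
φ∣4ax∧φ∣4aa⇒2x≡a (+ zero) _ _ (+<+ ()) _ _ _ _ _ _
φ∣4ax∧φ∣4aa⇒2x≡a _ (+ zero) _ _ (+<+ ()) _ _ _ _ _
φ∣4ax∧φ∣4aa⇒2x≡a a@(+[1+ A′ ]) x@(+[1+ X′ ]) m 0<a 0<x a≢3 a≢10 ρ φ∣4ax φ∣4aa =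
  begin
    + 2 * x          ≡⟨ cong (+ 2 *_) x≡βγ ⟩
    + 2 * (β * γ)    ≡⟨ ℤ.*-assoc (+ 2) β γ ⟨
    + 2 * β * γ      ≡⟨ cong (_* γ) 2β≡α ⟩
    α * γ            ≡⟨ a≡αγ ⟨
    a                ∎
  where
  open ≡-Reasoning
  A X : ℕ
  A = suc A′
  X = suc X′
  open CoprimeSplit (coprimeSplit A X)
  instance _ = g≢0
  α β γ : ℤ
  α = + m′
  β = + n′
  γ = + g
  a≡αγ : a ≡ α * γ
  a≡αγ = trans (cong +_ m≡m′*g) (ℤ.pos-* m′ g)
  x≡βγ : x ≡ β * γ
  x≡βγ = trans (cong +_ n≡n′*g) (ℤ.pos-* n′ g)
  0<γ : + 0 < γ
  0<γ = +<+ (ℕ.n≢0⇒n>0 (ℕ.≢-nonZero⁻¹ g))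
  0<α : + 0 < α
  0<α = 0<i∧0<i*j⇒0<j 0<γ (subst (+ 0 <_) (trans a≡αγ (ℤ.*-comm α γ)) 0<a)
  0<β : + 0 < β
  0<β = 0<i∧0<i*j⇒0<j 0<γ (subst (+ 0 <_) (trans x≡βγ (ℤ.*-comm β γ)) 0<x)
  φ≡γφ₀ : φ a x m ≡ γ * φ α β m
  φ≡γφ₀ = trans (cong₂ (λ a x → φ a x m) a≡αγ x≡βγ) (certificate α β γ m)
    where
    certificate : ∀ α β γ m →
      + 2 * (α * γ) + (+ 2 * (β * γ) - α * γ) * (m + + 1) ≡ γ * (+ 2 * α + (+ 2 * β - α) * (m + + 1))
    certificate = solve-∀
  -- ∣φ a x m∣ divides gcd(4a·a, 4a·x) = 4a·γ, and ∣φ a x m∣ = γ ∣φ α β m∣.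
  γ∣φ₀∣∣γ4A : g ℕ.* ∣ φ α β m ∣ ℕ.∣ g ℕ.* (4 ℕ.* A)
  γ∣φ₀∣∣γ4A = subst₂ ℕ._∣_ (trans (cong ∣_∣ φ≡γφ₀) (ℤ.abs-* γ (φ α β m)))
    (trans (sym (ℕ.c*gcd[m,n]≡gcd[cm,cn] (4 ℕ.* A) A X)) (ℕ.*-comm (4 ℕ.* A) g))
    (ℕ.gcd-greatest (∣⇒∣ᵤ φ∣4aa) (∣⇒∣ᵤ φ∣4ax))
  φ₀-bounds : φ α β m ≤ + (4 ℕ.* A) × - φ α β m ≤ + (4 ℕ.* A)
  φ₀-bounds = ∣i∣≤n⇒i≤n×-i≤n (φ α β m) (ℕ.∣⇒≤ (ℕ.*-cancelˡ-∣ g γ∣φ₀∣∣γ4A))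
  4A≡4αγ : + (4 ℕ.* A) ≡ + 4 * (α * γ)
  4A≡4αγ = cong (+ 4 *_) a≡αγ
  2β≡α : + 2 * β ≡ α
  2β≡α = φ-bound⇒2β≡α α β γ m 0<α 0<β 0<γ
    (subst₂ (λ x a → x * m ≡ (x + a) * (x + a)) x≡βγ a≡αγ ρ)
    (subst (φ α β m ≤_) 4A≡4αγ (proj₁ φ₀-bounds)) (subst (- φ α β m ≤_) 4A≡4αγ (proj₂ φ₀-bounds))
    (a≢3 ∘ trans a≡αγ) (a≢10 ∘ trans a≡αγ)

OnCurve : ℤ → ℤ → ℤ → ℤ → Set
OnCurve S m x y = ∃ λ (z : ℤ) →
  ((+ 2) * S ≡ z * ((+ 3) * z + (+ 1)) × (+ 2) * m ≡ (+ 9) * z * (z + (+ 1))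
    × (+ 2) * x ≡ z * (z + (+ 1)) × (+ 2) * y ≡ z * (z - (+ 1)))
  ⊎ (S ≡ z × m ≡ z × x ≡ z × y ≡ z)
  ⊎ (S ≡ z + (+ 1) × m ≡ z × x ≡ z × y ≡ z + (+ 1))

p₁-parametrisation : ∀ S m x y → ¬ S ≡ + 0 → p₁ S m x y ≡ + 0 →
                     ∃ λ t → S ≡ x + t * t × x * m ≡ (S + t) * (S + t)
p₁-parametrisation S m x y S≢0 p₁≡0 = conclude (b*b≡c*c*u⇒u≡t*t (+ 2 * S) b (S - x) 2S≢0 b*b≡2S*2S*[S-x])
  where
  b : ℤ
  b = x * m - S * S - S + x
  2S≢0 : ¬ + 2 * S ≡ + 0
  2S≢0 = i≢0∧j≢0⇒i*j≢0 {+ 2} (λ ()) S≢0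
  b*b≡2S*2S*[S-x] : b * b ≡ + 2 * S * (+ 2 * S) * (S - x)
  b*b≡2S*2S*[S-x] = ℤ.i-j≡0⇒i≡j _ _ (trans (certificate S m x y) (combination₁ (+ 1) p₁≡0))
    where
    certificate : ∀ S m x y →
      let b = x * m - S * S - S + x
          P₁ = S * S * S * S - (+ 2) * S * S * x * m + x * x * m * m - (+ 2) * S * S * S
            + (+ 2) * S * S * x - (+ 2) * S * x * m + (+ 2) * x * x * m + S * S
            - (+ 2) * S * x + x * x
      in b * b - + 2 * S * (+ 2 * S) * (S - x) ≡ + 1 * (P₁ - + 0)
    certificate = solve-∀
  conclude : (∃ λ t → b ≡ t * (+ 2 * S) × S - x ≡ t * t) →
             ∃ λ t → S ≡ x + t * t × x * m ≡ (S + t) * (S + t)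
  conclude (t , b≡t*2S , S-x≡t*t) =
    t , ℤ.i-j≡0⇒i≡j _ _ (trans (certificate₁ S x t) (combination₁ (+ 1) S-x≡t*t))
      , ℤ.i-j≡0⇒i≡j _ _ (trans (certificate₂ S m x t) (combination₂ (+ 1) (+ 1) b≡t*2S S-x≡t*t))
    where
    certificate₁ : ∀ S x t → S - (x + t * t) ≡ + 1 * ((S - x) - t * t)
    certificate₁ = solve-∀
    certificate₂ : ∀ S m x t → let b = x * m - S * S - S + x in
      x * m - (S + t) * (S + t) ≡ + 1 * (b - t * (+ 2 * S)) + + 1 * ((S - x) - t * t)
    certificate₂ = solve-∀

p₂≡0⇒m[d+t]≡2St : ∀ x t m y → let S = x + t * t ; d = x - y in
                  ¬ m ≡ + 0 → ¬ d - t ≡ + 0 → x * m ≡ (S + t) * (S + t) → p₂ S m x y ≡ + 0 →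
                  m * (d + t) ≡ + 2 * S * t
p₂≡0⇒m[d+t]≡2St x t m y m≢0 d-t≢0 ρ p₂≡0 =
  i≢0⇒i*[j-k]≡0⇒j≡k (i≢0∧j≢0⇒i*j≢0 (i≢0∧j≢0⇒i*j≢0 {+ 4} (λ ()) m≢0) d-t≢0)
    (trans (certificate x t m y) (combination₂ (+ 1) c p₂≡0 ρ))
  where
  S d c : ℤ
  S = x + t * t
  d = x - y
  c = + 4 * m * d - (x * m - S * S - S + x + + 2 * S * t)
  certificate : ∀ x t m y →
    let S = x + t * t
        d = x - y
        P₂ = S * S * S * S + (+ 2) * S * S * x * m - (+ 4) * S * S * y * m + x * x * m * m
          - (+ 4) * x * y * m * m + (+ 4) * y * y * m * m - (+ 2) * S * S * S
          + (+ 2) * S * S * x + (+ 8) * S * S * m - (+ 6) * S * x * m - (+ 2) * x * x * m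
          - (+ 4) * S * y * m + (+ 4) * x * y * m - (+ 4) * S * m * m + (+ 4) * x * m * m
          + S * S - (+ 2) * S * x + x * x
    in + 4 * m * (d - t) * (m * (d + t) - + 2 * S * t)
         ≡ + 1 * (P₂ - + 0) + (+ 4 * m * d - (x * m - S * S - S + x + + 2 * S * t)) * (x * m - (S + t) * (S + t))
  certificate = solve-∀

p₃≡0⇒quartic≡0 : ∀ x t m y → let S = x + t * t ; d = x - y in
                 ¬ t ≡ + 0 → ¬ S ≡ + 0 → ¬ m ≡ + 0 → ¬ d - t ≡ + 0 → x * m ≡ (S + t) * (S + t) →
                 m * (d + t) ≡ + 2 * S * t → p₃ S m x y ≡ + 0 →
                 (m + + 1) * (m + + 1) * t * t + + 4 * m * t - m * m ≡ + 0
p₃≡0⇒quartic≡0 x t m y t≢0 S≢0 m≢0 d-t≢0 ρ m[d+t]≡2St p₃≡0 =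
  trans (certificate x t m) (combination₂ (+ 4) ((m + + 1) * t + m - + 2 * S) mt≡S[m-S] [m+1]t+2S≡m)
  where
  S d : ℤ
  S = x + t * t
  d = x - y
  certificate : ∀ x t m → let S = x + t * t in
    (m + + 1) * (m + + 1) * t * t + + 4 * m * t - m * m
      ≡ + 4 * (m * t - S * (m - S)) + ((m + + 1) * t + m - + 2 * S) * ((m + + 1) * t + + 2 * S - m)
  certificate = solve-∀
  4t³+m[d²-t²]≡0 : + 4 * t * t * t + m * (d * d - t * t) ≡ + 0
  4t³+m[d²-t²]≡0 = i≢0⇒i*[j-k]≡0⇒j≡k (i≢0∧j≢0⇒i*j≢0 S≢0 d-t≢0)
    (trans (certificate₁ x t m y)
      (combination₃ (+ 2 * t * t * t) (t * t * d * d - t * t * t * t + x * d * d - x * t * t) (+ 2 * t)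
                    ρ m[d+t]≡2St p₃≡0))
    where
    certificate₁ : ∀ x t m y →
      let S = x + t * t
          d = x - y
          P₃ = S * S * x * x - S * m * x * x - (+ 2) * S * S * x * y + (+ 2) * S * m * x * y
            + S * S * y * y - S * m * y * y + S * S * m + (+ 2) * S * S * x
            - (+ 2) * S * m * x - (+ 2) * S * x * x + m * x * x - (+ 2) * S * S * y
            + (+ 2) * S * x * y + S * S - (+ 2) * S * x + x * x
      in S * (d - t) * ((+ 4 * t * t * t + m * (d * d - t * t)) - + 0)
           ≡ + 2 * t * t * t * (x * m - (S + t) * (S + t))
             + (t * t * d * d - t * t * t * t + x * d * d - x * t * t) * (m * (d + t) - + 2 * S * t)
             + + 2 * t * (P₃ - + 0)
    certificate₁ = solve-∀
  mt≡S[m-S] : m * t ≡ S * (m - S)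
  mt≡S[m-S] = i≢0⇒i*[j-k]≡0⇒j≡k (i≢0∧j≢0⇒i*j≢0 (i≢0∧j≢0⇒i*j≢0 {+ 4} (λ ()) t≢0) t≢0)
    (trans (certificate₂ x t m y)
      (combination₂ (- (m * d) + t * m - + 2 * t * t * t - + 2 * x * t) m m[d+t]≡2St 4t³+m[d²-t²]≡0))
    where
    certificate₂ : ∀ x t m y → let S = x + t * t ; d = x - y in
      + 4 * t * t * (m * t - S * (m - S))
        ≡ (- (m * d) + t * m - + 2 * t * t * t - + 2 * x * t) * (m * (d + t) - + 2 * S * t)
          + m * ((+ 4 * t * t * t + m * (d * d - t * t)) - + 0)
    certificate₂ = solve-∀
  [m+1]t+2S≡m : (m + + 1) * t + + 2 * S ≡ m
  [m+1]t+2S≡m = i≢0⇒i*[j-k]≡0⇒j≡k (i≢0∧j≢0⇒i*j≢0 m≢0 d-t≢0)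
    (trans (certificate₃ x t m y)
      (combination₃ (+ 2 * m - + 2 * t * t - + 2 * x) (- m + t + t * m + + 2 * t * t + + 2 * x)
                    (+ 2 * m - + 2 * t * t - + 2 * x) ρ m[d+t]≡2St mt≡S[m-S]))
    where
    certificate₃ : ∀ x t m y → let S = x + t * t ; d = x - y in
      m * (d - t) * ((m + + 1) * t + + 2 * S - m)
        ≡ (+ 2 * m - + 2 * t * t - + 2 * x) * (x * m - (S + t) * (S + t))
          + (- m + t + t * m + + 2 * t * t + + 2 * x) * (m * (d + t) - + 2 * S * t)
          + (+ 2 * m - + 2 * t * t - + 2 * x) * (m * t - S * (m - S))
    certificate₃ = solve-∀

p₂≡0∧p₃≡0⇒y≡x-t : ∀ x t m y → let S = x + t * t in
                  + 0 < x → ¬ t ≡ + 0 → ¬ S ≡ + 0 → ¬ m ≡ + 0 → x * m ≡ (S + t) * (S + t) →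
                  p₂ S m x y ≡ + 0 → p₃ S m x y ≡ + 0 → y ≡ x - t
p₂≡0∧p₃≡0⇒y≡x-t x t m y 0<x t≢0 S≢0 m≢0 ρ p₂≡0 p₃≡0 with y ℤ.≟ x - t
... | yes y≡x-t = y≡x-t
... | no y≢x-t = ⊥-elim (quartic≢0 m t 0<m t≢0
       (p₃≡0⇒quartic≡0 x t m y t≢0 S≢0 m≢0 d-t≢0 ρ (p₂≡0⇒m[d+t]≡2St x t m y m≢0 d-t≢0 ρ p₂≡0) p₃≡0))
  where
  d-t≢0 : ¬ (x - y) - t ≡ + 0
  d-t≢0 d-t≡0 = y≢x-t (ℤ.i-j≡0⇒i≡j y (x - t) (trans (certificate x t y) (combination₁ (- + 1) d-t≡0)))
    where
    certificate : ∀ x t y → y - (x - t) ≡ - + 1 * ((x - y - t) - + 0)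
    certificate = solve-∀
  0<m : + 0 < m
  0<m = 0≤i∧i≢0⇒0<i (0<i∧0≤i*j⇒0≤j 0<x (subst (+ 0 ≤_) (sym ρ) (0≤i*i (x + t * t + t)))) m≢0

-- On the branch y = x - t, φ (t² + t) x m is the denominator of Λ, T, n and r.
closed-forms : ∀ x t m → let S = x + t * t ; a = t * t + t in
               ¬ t ≡ + 0 → ¬ S ≡ + 0 → x * m ≡ (S + t) * (S + t) →
               (ie : IntegralityEquations S m x (x - t)) → let open IntegralityEquations ie in
               Λ * φ a x m ≡ a * S * (S - + 1) × n * φ a x m ≡ a * m * (m - + 1)
                 × (r + t + + 1) * φ a x m ≡ (t + + 1) * S * (m - S)
closed-forms x t m t≢0 S≢0 ρ ie = Λφ≡aS[S-1] , nφ≡am[m-1] , [r+t+1]φ≡[t+1]S[m-S]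
  where
  open IntegralityEquations ie
  S a : ℤ
  S = x + t * t
  a = t * t + t
  Λφ≡aS[S-1] : Λ * φ a x m ≡ a * S * (S - + 1)
  Λφ≡aS[S-1] = i≢0⇒i*[j-k]≡0⇒j≡k (i≢0∧j≢0⇒i*j≢0 t≢0 t≢0)
    (trans (certificate x t m Λ) (combination₂ (+ 1) c Λ-eq ρ))
    where
    c : ℤ
    c = - Λ * (t - t * m - t * t + + 2 * t * t * t - t * t * t * t + x * m + + 2 * x * t - + 2 * x * t * t - x * x)
    certificate : ∀ x t m Λ →
      let S = x + t * t
          y = x - t
          a = t * t + t
          φ = + 2 * a + (+ 2 * x - a) * (m + + 1)
          denΛ = S * S * S * S - + 2 * S * S * S - ((x + y - + 1) * (m - + 1) - + 1) * S * S + x * y * m * (m - + 1)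
          numΛ = S * (S - + 1) * (S - x) * (S - y)
      in t * t * (Λ * φ - a * S * (S - + 1))
           ≡ + 1 * (Λ * denΛ - numΛ)
             + - Λ * (t - t * m - t * t + + 2 * t * t * t - t * t * t * t + x * m + + 2 * x * t - + 2 * x * t * t - x * x)
               * (x * m - (S + t) * (S + t))
    certificate = solve-∀
  Tφ≡[m-1]Sa : T * φ a x m ≡ (m - + 1) * S * a
  Tφ≡[m-1]Sa = i≢0⇒i*[j-k]≡0⇒j≡k S-1≢0
    (trans (certificate x t m Λ T (φ a x m)) (combination₂ (φ a x m) (m - + 1) T-eq Λφ≡aS[S-1]))
    where
    certificate : ∀ x t m Λ T f → let S = x + t * t ; a = t * t + t in
      (S - + 1) * (T * f - (m - + 1) * S * a)
        ≡ f * (T * (S - + 1) - (m - + 1) * Λ) + (m - + 1) * (Λ * f - a * S * (S - + 1))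
    certificate = solve-∀
  nφ≡am[m-1] : n * φ a x m ≡ a * m * (m - + 1)
  nφ≡am[m-1] = i≢0⇒i*[j-k]≡0⇒j≡k S≢0
    (trans (certificate x t m T n (φ a x m)) (combination₂ (φ a x m) m n-eq Tφ≡[m-1]Sa))
    where
    certificate : ∀ x t m T n f → let S = x + t * t ; a = t * t + t in
      S * (n * f - a * m * (m - + 1)) ≡ f * (n * S - m * T) + m * (T * f - (m - + 1) * S * a)
    certificate = solve-∀
  [r+t+1]φ≡[t+1]S[m-S] : (r + t + + 1) * φ a x m ≡ (t + + 1) * S * (m - S)
  [r+t+1]φ≡[t+1]S[m-S] = i≢0⇒i*[j-k]≡0⇒j≡k (i≢0∧j≢0⇒i*j≢0 t≢0 S-1≢0)
    (trans (certificate x t m Λ r (φ a x m)) (combination₂ (φ a x m) (m - S) r-eq Λφ≡aS[S-1]))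
    where
    certificate : ∀ x t m Λ r f → let S = x + t * t ; a = t * t + t ; y = x - t in
      t * (S - + 1) * ((r + t + + 1) * f - (t + + 1) * S * (m - S))
        ≡ f * ((r * (x - y) + (S - y)) * (S - + 1) - (m - S) * Λ) + (m - S) * (Λ * f - a * S * (S - + 1))
    certificate = solve-∀

φ∣4ax×φ∣4aa : ∀ x t m → let S = x + t * t ; a = t * t + t in
              ¬ t ≡ + 0 → ¬ S ≡ + 0 → x * m ≡ (S + t) * (S + t) →
              IntegralityEquations S m x (x - t) →
              φ a x m ℤ.∣ + 4 * a * x × φ a x m ℤ.∣ + 4 * a * a
φ∣4ax×φ∣4aa x t m t≢0 S≢0 ρ ie = divides q₁ 4ax≡q₁φ , divides q₂ 4aa≡q₂φ
  where
  open IntegralityEquations ie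
  S a : ℤ
  S = x + t * t
  a = t * t + t
  Λφ≡aS[S-1] : Λ * φ a x m ≡ a * S * (S - + 1)
  Λφ≡aS[S-1] = proj₁ (closed-forms x t m t≢0 S≢0 ρ ie)
  nφ≡am[m-1] : n * φ a x m ≡ a * m * (m - + 1)
  nφ≡am[m-1] = proj₁ (proj₂ (closed-forms x t m t≢0 S≢0 ρ ie))
  [r+t+1]φ≡[t+1]S[m-S] : (r + t + + 1) * φ a x m ≡ (t + + 1) * S * (m - S)
  [r+t+1]φ≡[t+1]S[m-S] = proj₂ (proj₂ (closed-forms x t m t≢0 S≢0 ρ ie))
  q₁ q₂ : ℤ
  q₁ = - (+ 4 * n) + + 10 * m + + 14 * m * r - + 3 * m * n - + 3 * m * m + + 8 * t - + 8 * t * n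
       + + 14 * t * m + + 8 * t * t + + 6 * t * t * n + + 4 * x + + 15 * x * n + + 3 * x * m
  q₂ = + 5 + + 5 * r + + 8 * Λ - + 3 * m - + 3 * m * r + + 18 * t + + 14 * t * r + + 9 * t * Λ
       - + 6 * t * m + + 25 * t * t + + 9 * t * t * r + + 12 * t * t * t + + 3 * x * t
  4ax≡q₁φ : + 4 * a * x ≡ q₁ * φ a x m
  4ax≡q₁φ = sym (ℤ.i-j≡0⇒i≡j _ _ (trans (certificate x t m n r)
    (combination₃ (- (+ 8) - + 6 * m * m + + 14 * t * m) (- (+ 4) - + 3 * m - + 8 * t + + 6 * t * t + + 15 * x)
                  (+ 14 * m) ρ nφ≡am[m-1] [r+t+1]φ≡[t+1]S[m-S])))
    where
    certificate : ∀ x t m n r →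
      let S = x + t * t
          a = t * t + t
          φ = + 2 * a + (+ 2 * x - a) * (m + + 1)
          q₁ = - (+ 4 * n) + + 10 * m + + 14 * m * r - + 3 * m * n - + 3 * m * m + + 8 * t - + 8 * t * n
               + + 14 * t * m + + 8 * t * t + + 6 * t * t * n + + 4 * x + + 15 * x * n + + 3 * x * m
      in q₁ * φ - + 4 * a * x
           ≡ (- (+ 8) - + 6 * m * m + + 14 * t * m) * (x * m - (S + t) * (S + t))
             + (- (+ 4) - + 3 * m - + 8 * t + + 6 * t * t + + 15 * x) * (n * φ - a * m * (m - + 1))
             + + 14 * m * ((r + t + + 1) * φ - (t + + 1) * S * (m - S))
    certificate = solve-∀
  4aa≡q₂φ : + 4 * a * a ≡ q₂ * φ a x m
  4aa≡q₂φ = sym (ℤ.i-j≡0⇒i≡j _ _ (trans (certificate x t m Λ r)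
    (combination₃ (+ 5 - + 3 * m + + 5 * t - + 9 * t * m + + 6 * t * t) (+ 8 + + 9 * t)
                  (+ 5 - + 3 * m + + 14 * t + + 9 * t * t) ρ Λφ≡aS[S-1] [r+t+1]φ≡[t+1]S[m-S])))
    where
    certificate : ∀ x t m Λ r →
      let S = x + t * t
          a = t * t + t
          φ = + 2 * a + (+ 2 * x - a) * (m + + 1)
          q₂ = + 5 + + 5 * r + + 8 * Λ - + 3 * m - + 3 * m * r + + 18 * t + + 14 * t * r + + 9 * t * Λ
               - + 6 * t * m + + 25 * t * t + + 9 * t * t * r + + 12 * t * t * t + + 3 * x * t
      in q₂ * φ - + 4 * a * a
           ≡ (+ 5 - + 3 * m + + 5 * t - + 9 * t * m + + 6 * t * t) * (x * m - (S + t) * (S + t))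
             + (+ 8 + + 9 * t) * (Λ * φ - a * S * (S - + 1))
             + (+ 5 - + 3 * m + + 14 * t + + 9 * t * t) * ((r + t + + 1) * φ - (t + + 1) * S * (m - S))
    certificate = solve-∀

2x≡a⇒curve : ∀ x t m → let S = x + t * t ; a = t * t + t in
             ¬ a ≡ + 0 → x * m ≡ (S + t) * (S + t) → + 2 * x ≡ a →
             (+ 2) * S ≡ t * ((+ 3) * t + (+ 1)) × (+ 2) * m ≡ (+ 9) * t * (t + (+ 1))
               × (+ 2) * x ≡ t * (t + (+ 1)) × (+ 2) * (x - t) ≡ t * (t - (+ 1))
2x≡a⇒curve x t m a≢0 ρ 2x≡a =
    ℤ.i-j≡0⇒i≡j _ _ (trans (certificate₁ x t) (combination₁ (+ 1) 2x≡a))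
  , i≢0⇒i*[j-k]≡0⇒j≡k a≢0 (trans (certificate₂ x t m)
      (combination₂ (+ 4) (- (+ 2 * m - + 6 * (t * t + t) - (+ 2 * x - (t * t + t)))) ρ 2x≡a))
  , ℤ.i-j≡0⇒i≡j _ _ (trans (certificate₃ x t) (combination₁ (+ 1) 2x≡a))
  , ℤ.i-j≡0⇒i≡j _ _ (trans (certificate₄ x t) (combination₁ (+ 1) 2x≡a))
  where
  certificate₁ : ∀ x t → + 2 * (x + t * t) - t * (+ 3 * t + + 1) ≡ + 1 * (+ 2 * x - (t * t + t))
  certificate₁ = solve-∀
  certificate₂ : ∀ x t m → let S = x + t * t ; a = t * t + t in
    a * (+ 2 * m - + 9 * t * (t + + 1))
      ≡ + 4 * (x * m - (S + t) * (S + t)) + (- (+ 2 * m - + 6 * a - (+ 2 * x - a))) * (+ 2 * x - a)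
  certificate₂ = solve-∀
  certificate₃ : ∀ x t → + 2 * x - t * (t + + 1) ≡ + 1 * (+ 2 * x - (t * t + t))
  certificate₃ = solve-∀
  certificate₄ : ∀ x t → + 2 * (x - t) - t * (t - + 1) ≡ + 1 * (+ 2 * x - (t * t + t))
  certificate₄ = solve-∀

y≡x-t⇒on-curve : ∀ x t m → let S = x + t * t in
                 + 0 < x → ¬ t ≡ + 0 → ¬ S ≡ + 0 → x * m ≡ (S + t) * (S + t) →
                 IntegralityEquations S m x (x - t) → OnCurve S m x (x - t)
y≡x-t⇒on-curve x t m 0<x t≢0 S≢0 ρ ie with t ℤ.≟ - + 1
... | yes refl = x , inj₂ (inj₂ (refl , m≡x , refl , refl))
  where
  m≡x : m ≡ x
  m≡x = i≢0⇒i*[j-k]≡0⇒j≡k (i>0⇒i≢0 0<x) (trans (certificate x m) (combination₁ (+ 1) ρ))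
    where
    certificate : ∀ x m → let t = - + 1 ; S = x + t * t in x * (m - x) ≡ + 1 * (x * m - (S + t) * (S + t))
    certificate = solve-∀
... | no t≢-1 = t , inj₁ (2x≡a⇒curve x t m (i>0⇒i≢0 0<a) ρ
                  (φ∣4ax∧φ∣4aa⇒2x≡a a x m 0<a 0<x (proj₁ (t*t+t≢3,10 t)) (proj₂ (t*t+t≢3,10 t))
                    x*m≡[x+a]² (proj₁ φ∣4ax×φ∣4aa′) (proj₂ φ∣4ax×φ∣4aa′)))
  where
  a : ℤ
  a = t * t + t
  0<a : + 0 < a
  0<a = t*t+t>0 t t≢0 t≢-1
  x*m≡[x+a]² : x * m ≡ (x + a) * (x + a)
  x*m≡[x+a]² = trans ρ (cong (λ u → u * u) (ℤ.+-assoc x (t * t) t))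
  φ∣4ax×φ∣4aa′ : φ a x m ℤ.∣ + 4 * a * x × φ a x m ℤ.∣ + 4 * a * a
  φ∣4ax×φ∣4aa′ = φ∣4ax×φ∣4aa x t m t≢0 S≢0 ρ ie

S-x≢0⇒t≢0 : ∀ x t → ¬ (x + t * t) - x ≡ + 0 → ¬ t ≡ + 0
S-x≢0⇒t≢0 x t S-x≢0 t≡0 = S-x≢0 (trans (certificate x t) (cong (λ t → t * t) t≡0))
  where
  certificate : ∀ x t → (x + t * t) - x ≡ t * t
  certificate = solve-∀

on-curve : ∀ S m x y → + 0 < x → ¬ S ≡ + 0 → ¬ m ≡ + 0 → p₂ S m x y ≡ + 0 → p₃ S m x y ≡ + 0 →
           (∃ λ t → S ≡ x + t * t × x * m ≡ (S + t) * (S + t)) → IntegralityEquations S m x y →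
           OnCurve S m x y
on-curve .(x + t * t) m x y 0<x S≢0 m≢0 p₂≡0 p₃≡0 (t , refl , ρ) ie
  with p₂≡0∧p₃≡0⇒y≡x-t x t m y 0<x (S-x≢0⇒t≢0 x t (IntegralityEquations.S-x≢0 ie)) S≢0 m≢0 ρ p₂≡0 p₃≡0
... | refl = y≡x-t⇒on-curve x t m 0<x (S-x≢0⇒t≢0 x t (IntegralityEquations.S-x≢0 ie)) S≢0 ρ ie

theorem7 : (S m x y : ℤ) →
    p₁ S m x y ≡ + 0 → p₂ S m x y ≡ + 0 → p₃ S m x y ≡ + 0 →
    ¬ S ≡ + 0 → ¬ m ≡ + 0 → x ≥ + 1 →
    AllIntegral S m x y →
    ∃ λ (z : ℤ) →
      ((+ 2) * S ≡ z * ((+ 3) * z + (+ 1)) × (+ 2) * m ≡ (+ 9) * z * (z + (+ 1))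
        × (+ 2) * x ≡ z * (z + (+ 1)) × (+ 2) * y ≡ z * (z - (+ 1)))
      ⊎ (S ≡ z × m ≡ z × x ≡ z × y ≡ z)
      ⊎ (S ≡ z + (+ 1) × m ≡ z × x ≡ z × y ≡ z + (+ 1))
theorem7 S m x y p₁≡0 p₂≡0 p₃≡0 S≢0 m≢0 x≥1 integral =
  on-curve S m x y (ℤ.<-≤-trans (+<+ (s≤s z≤n)) x≥1) S≢0 m≢0 p₂≡0 p₃≡0
    (p₁-parametrisation S m x y S≢0 p₁≡0) (integralityEquations S m x y integral)
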